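{- Let $G$ be a signed eulerian graph that admits a stable nowhere-zero $3$-flow. Then $G$ is antibalanced and the valency of every vertex of $G$ is a multiple of $6$.
   Context: Graphs are finite and may have loops and multiple edges. A graph is eulerian if it is connected and every vertex has even valency. A signed graph is a graph with a signature $\sigma:E\to\{+1,-1\}$; it is balanced if every circuit has an even number of negative edges, and antibalanced if it becomes balanced after replacing $\sigma$ by $-\sigma$. Orientation: each edge has two half-edges; positive edges have exactly one half-edge pointing toward its end, negative edges have both pointing away or both toward their ends. A $\mathbb{Z}$-flow is $\xi:E\to\mathbb{Z}$ such that at each vertex the sum of values on half-edges directed out minus the sum on half-edges directed in is $0$; reversing both half-edges of an edge and negating its value preserves flows. A nowhere-zero $3$-flow takes values in $\{\pm1,\pm2\}$. Given a nowhere-zero $3$-flow $\phi$, orient $G$ positively, i.e. so that every edge carries a positive value ($1$ or $2$). Then $\phi$ is stable at a vertex $v$ if for any two edges $e,f$ incident with $v$ with $\phi(e)=\phi(f)$, either both are directed towards $v$ or both are directed out of $v$ (at $v$); $\phi$ is stable if it is stable at every vertex. -}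

module Defs where

open import Data.Nat using (ℕ; zero; suc)
open import Data.Fin using (Fin; zero; suc; inject₁; fromℕ; _≟_)
open import Data.Integer using (ℤ; +_; -[1+_]; _+_; -_; ∣_∣) renaming (1ℤ to one)
open import Data.List using (List; length; filter; map; foldr; cartesianProduct; allFin)
open import Data.Product using (_×_; _,_; proj₁; proj₂; Σ; Σ-syntax)
open import Data.Sum using (_⊎_)
open import Data.Nat.Divisibility using (_∣_)
open import Relation.Binary.PropositionalEquality using (_≡_; _≢_; refl)
open import Relation.Nullary using (Dec; yes; no)
open import Function using (_∘_; Injective)

data Sign : Set where
  pos neg : Sign

negateSign : Sign → Sign
negateSign pos = neg
negateSign neg = pos

-- Vertices are Fin n, edges are Fin m.  Edge e has two half-edges,
-- numbered 0 and 1; half-edge 0 is attached to proj₁ (ends e) and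
-- half-edge 1 to proj₂ (ends e).  A loop has both ends equal.
record SignedGraph : Set where
  field
    n    : ℕ
    m    : ℕ
    ends : Fin m → Fin n × Fin n
    σ    : Fin m → Sign

open SignedGraph public

HalfEdge : SignedGraph → Set
HalfEdge G = Fin (m G) × Fin 2

endOf : (G : SignedGraph) → HalfEdge G → Fin (n G)
endOf G (e , zero)  = proj₁ (ends G e)
endOf G (e , suc _) = proj₂ (ends G e)

allHalfEdges : (G : SignedGraph) → List (HalfEdge G)
allHalfEdges G = cartesianProduct (allFin (m G)) (allFin 2)

-- half-edges incident with v (a loop at v contributes two)
halfEdgesAt : (G : SignedGraph) → Fin (n G) → List (HalfEdge G)
halfEdgesAt G v = filter (λ h → endOf G h ≟ v) (allHalfEdges G)

valency : (G : SignedGraph) → Fin (n G) → ℕ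
valency G v = length (halfEdgesAt G v)

Joins : (G : SignedGraph) → Fin (m G) → Fin (n G) → Fin (n G) → Set
Joins G e x y = (ends G e ≡ (x , y)) ⊎ (ends G e ≡ (y , x))

data Walk (G : SignedGraph) : Fin (n G) → Fin (n G) → Set where
  here : ∀ {v} → Walk G v v
  step : ∀ {u w x} (e : Fin (m G)) → Joins G e u w → Walk G w x → Walk G u x

Connected : SignedGraph → Set
Connected G = ∀ u v → Walk G u v

Eulerian : SignedGraph → Set
Eulerian G = Connected G × (∀ v → 2 ∣ valency G v)

-- A circuit of length k+1: vertices w₀,…,w_k (pairwise distinct),
-- with w_{k+1} = w₀, and pairwise distinct edges e₀,…,e_k where e_i
-- joins w_i and w_{i+1}.  (k = 0: a loop; k = 1: two parallel edges.)
record Circuit (G : SignedGraph) : Set where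
  field
    len-1  : ℕ
    vert   : Fin (suc (suc len-1)) → Fin (n G)
    edge   : Fin (suc len-1) → Fin (m G)
    closed : vert (fromℕ (suc len-1)) ≡ vert zero
    vert-distinct : Injective _≡_ _≡_ (vert ∘ inject₁)
    edge-distinct : Injective _≡_ _≡_ edge
    joins  : ∀ i → Joins G (edge i) (vert (inject₁ i)) (vert (suc i))

isNeg : (s : Sign) → Dec (s ≡ neg)
isNeg pos = no (λ ())
isNeg neg = yes refl

numNegative : (G : SignedGraph) → Circuit G → ℕ
numNegative G C = length (filter (λ i → isNeg (σ G (Circuit.edge C i))) (allFin (suc (Circuit.len-1 C))))

Balanced : SignedGraph → Set
Balanced G = (C : Circuit G) → 2 ∣ numNegative G C

negateSignature : SignedGraph → SignedGraph
negateSignature G = record G { σ = negateSign ∘ σ G }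

Antibalanced : SignedGraph → Set
Antibalanced G = Balanced (negateSignature G)

-- direction of a half-edge relative to its end vertex
data Dir : Set where
  out inward : Dir

flipDir : Dir → Dir
flipDir out = inward
flipDir inward = out

Orientation : SignedGraph → Set
Orientation G = HalfEdge G → Dir

ValidOrientation : (G : SignedGraph) → Orientation G → Set
ValidOrientation G ω = ∀ e → SignCond (σ G e) (ω (e , zero)) (ω (e , suc zero))
  where
  SignCond : Sign → Dir → Dir → Set
  SignCond pos d d' = d ≢ d'
  SignCond neg d d' = d ≡ d'

sumℤ : List ℤ → ℤ
sumℤ = foldr _+_ (+ 0)

contrib : Dir → ℤ → ℤ
contrib out x = x
contrib inward x = - x

IsFlow : (G : SignedGraph) → Orientation G → (Fin (m G) → ℤ) → Set
IsFlow G ω ξ = ∀ v → sumℤ (map (λ h → contrib (ω h) (ξ (proj₁ h))) (halfEdgesAt G v)) ≡ + 0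

NowhereZero3 : (G : SignedGraph) → (Fin (m G) → ℤ) → Set
NowhereZero3 G ξ = ∀ e → (ξ e ≡ + 1) ⊎ (ξ e ≡ + 2) ⊎ (ξ e ≡ -[1+ 0 ]) ⊎ (ξ e ≡ -[1+ 1 ])

flipIfNeg : ℤ → Dir → Dir
flipIfNeg (+ _) d = d
flipIfNeg -[1+ _ ] d = flipDir d

positiveOrientation : (G : SignedGraph) → Orientation G → (Fin (m G) → ℤ) → Orientation G
positiveOrientation G ω ξ h = flipIfNeg (ξ (proj₁ h)) (ω h)

positiveValue : (G : SignedGraph) → (Fin (m G) → ℤ) → Fin (m G) → ℕ
positiveValue G ξ e = ∣ ξ e ∣

StableAt : (G : SignedGraph) → Orientation G → (Fin (m G) → ℤ) → Fin (n G) → Set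
StableAt G ω ξ v = (h h' : HalfEdge G) → h ≢ h' → endOf G h ≡ v → endOf G h' ≡ v →
  positiveValue G ξ (proj₁ h) ≡ positiveValue G ξ (proj₁ h') →
  positiveOrientation G ω ξ h ≡ positiveOrientation G ω ξ h'

Stable : (G : SignedGraph) → Orientation G → (Fin (m G) → ℤ) → Set
Stable G ω ξ = ∀ v → StableAt G ω ξ v

AdmitsStableNZ3Flow : SignedGraph → Set
AdmitsStableNZ3Flow G =
  Σ[ ω ∈ Orientation G ] Σ[ ξ ∈ (Fin (m G) → ℤ) ]
    ValidOrientation G ω × IsFlow G ω ξ × NowhereZero3 G ξ × Stable G ω ξ

-- Measure the flow at a vertex v by its contributions z ∈ {±1, ±2} (the value, negated on
-- half-edges directed into v).  Stability says that all contributions of absolute value 1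
-- are equal, and so are all those of absolute value 2.  Since they sum to zero, the two
-- kinds have opposite signs, so all contributions at v lie either in {1, -2} or in {-1, 2}:
-- they are congruent modulo 3, and their sum 0 is congruent to deg(v) times that residue,
-- so 3 divides deg(v).  The two contributions of an edge are opposite if the edge is
-- positive and equal if it is negative, so the residue class changes exactly along the
-- positive edges; on a circuit it changes an even number of times, which makes every
-- circuit have an even number of positive edges.
module Submission where

open import Defs
open import Data.Bool using (Bool; true; false; not; _xor_)
open import Data.Bool.Properties using (not-involutive; xor-same; xor-comm; xor-assoc)
open import Data.Empty using (⊥-elim)
open import Data.Fin using (Fin; zero; suc; inject₁; fromℕ) renaming (_≟_ to _≟ᶠ_)
open import Data.Integer using (ℤ; +_; -[1+_]; -_; _+_; _-_; ∣_∣)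
open import Data.Integer.Properties as ℤP
  using (neg-involutive; neg-distrib-+; neg-injective; ∣-i∣≡∣i∣; +∣i∣≡i⊎+∣i∣≡-i; i-j≡0⇒i≡j; +-assoc; +-comm)
open import Data.List using (List; []; _∷_; length; filter; map; tabulate)
open import Data.List.Membership.Propositional using (_∈_)
open import Data.List.Membership.Propositional.Properties
  using (∈-map⁻; ∈-filter⁻; ∈-filter⁺; ∈-cartesianProduct⁺; ∈-allFin)
open import Data.List.Membership.DecPropositional ℤP._≟_ using (_∈?_)
open import Data.List.Properties using (length-map)
open import Data.List.Relation.Unary.All as All using (All; []; _∷_)
open import Data.List.Relation.Unary.All.Properties using (map⁻)
open import Data.Nat as ℕ using (ℕ; zero; suc; _*_)
open import Data.Nat.Divisibility using (_∣_; divides; _∣0)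
open import Data.Nat.LCM using (lcm-least)
open import Data.Nat.Properties as ℕP using (m+n≡0⇒m≡0; m+n≡0⇒n≡0; m*n≡0⇒m≡0)
open import Data.Product using (_×_; _,_; proj₁; proj₂; Σ-syntax; ∃₂)
open import Data.Product.Properties using (≡-dec)
open import Data.Sum as Sum using (_⊎_; inj₁; inj₂)
open import Function using (_∘_; id; case_of_)
open import Relation.Binary.PropositionalEquality
open import Relation.Nullary using (yes; no; does)
open import Relation.Unary using (Decidable)

isOdd : ℕ → Bool
isOdd zero    = false
isOdd (suc n) = not (isOdd n)

isOdd≡false⇒2∣ : ∀ n → isOdd n ≡ false → 2 ∣ n
isOdd≡false⇒2∣ zero          _    = 2 ∣0
isOdd≡false⇒2∣ (suc (suc n)) even with isOdd≡false⇒2∣ n (trans (sym (not-involutive (isOdd n))) even)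
... | divides r n≡r*2 = divides (suc r) (cong (ℕ.suc ∘ ℕ.suc) n≡r*2)

isOdd-length-filter-∷ : ∀ {A : Set} {P : A → Set} (P? : Decidable P) x xs →
  isOdd (length (filter P? (x ∷ xs))) ≡ does (P? x) xor isOdd (length (filter P? xs))
isOdd-length-filter-∷ P? x xs with does (P? x)
... | true  = refl
... | false = refl

xor-not-self : ∀ b → b xor not b ≡ true
xor-not-self true  = refl
xor-not-self false = refl

xor-telescope : ∀ a b c → (a xor b) xor (b xor c) ≡ a xor c
xor-telescope a b c = begin
  (a xor b) xor (b xor c) ≡⟨ xor-assoc a b (b xor c) ⟩
  a xor (b xor (b xor c)) ≡⟨ cong (a xor_) (sym (xor-assoc b b c)) ⟩
  a xor ((b xor b) xor c) ≡⟨ cong (λ x → a xor (x xor c)) (xor-same b) ⟩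
  a xor c                 ∎
  where open ≡-Reasoning

isOdd-count-changes : ∀ {A : Set} {P : A → Set} (P? : Decidable P) k (f : Fin k → A)
  (w : Fin (suc k) → Bool) → (∀ i → does (P? (f i)) ≡ w (inject₁ i) xor w (suc i)) →
  isOdd (length (filter P? (tabulate f))) ≡ w zero xor w (fromℕ k)
isOdd-count-changes P? zero    f w changes = sym (xor-same (w zero))
isOdd-count-changes P? (suc k) f w changes = begin
  isOdd (length (filter P? (tabulate f)))
    ≡⟨ isOdd-length-filter-∷ P? (f zero) (tabulate (f ∘ suc)) ⟩
  does (P? (f zero)) xor isOdd (length (filter P? (tabulate (f ∘ suc))))
    ≡⟨ cong₂ _xor_ (changes zero) (isOdd-count-changes P? k (f ∘ suc) (w ∘ suc) (changes ∘ suc)) ⟩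
  (w zero xor w (suc zero)) xor (w (suc zero) xor w (fromℕ (suc k)))
    ≡⟨ xor-telescope (w zero) (w (suc zero)) (w (fromℕ (suc k))) ⟩
  w zero xor w (fromℕ (suc k)) ∎
  where open ≡-Reasoning

data NZ3 : ℤ → Set where
  plus-one   : NZ3 (+ 1)
  plus-two   : NZ3 (+ 2)
  minus-one  : NZ3 -[1+ 0 ]
  minus-two  : NZ3 -[1+ 1 ]

toNZ3 : ∀ {z} → (z ≡ + 1) ⊎ (z ≡ + 2) ⊎ (z ≡ -[1+ 0 ]) ⊎ (z ≡ -[1+ 1 ]) → NZ3 z
toNZ3 (inj₁ refl)               = plus-one
toNZ3 (inj₂ (inj₁ refl))        = plus-two
toNZ3 (inj₂ (inj₂ (inj₁ refl))) = minus-one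
toNZ3 (inj₂ (inj₂ (inj₂ refl))) = minus-two

NZ3⇒∣∣≡1⊎∣∣≡2 : ∀ {z} → NZ3 z → ∣ z ∣ ≡ 1 ⊎ ∣ z ∣ ≡ 2
NZ3⇒∣∣≡1⊎∣∣≡2 plus-one  = inj₁ refl
NZ3⇒∣∣≡1⊎∣∣≡2 plus-two  = inj₂ refl
NZ3⇒∣∣≡1⊎∣∣≡2 minus-one = inj₁ refl
NZ3⇒∣∣≡1⊎∣∣≡2 minus-two = inj₂ refl

-- On {±1, ±2}: whether z ≡ 1 (mod 3).
isOneMod3 : ℤ → Bool
isOneMod3 (+ 1)    = true
isOneMod3 -[1+ 1 ] = true
isOneMod3 _        = false

isOneMod3-neg : ∀ {z} → NZ3 z → isOneMod3 (- z) ≡ not (isOneMod3 z)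
isOneMod3-neg plus-one  = refl
isOneMod3-neg plus-two  = refl
isOneMod3-neg minus-one = refl
isOneMod3-neg minus-two = refl

contrib-+ : ∀ d x y → contrib d (x + y) ≡ contrib d x + contrib d y
contrib-+ out    x y = refl
contrib-+ inward x y = neg-distrib-+ x y

contrib-0 : ∀ d → contrib d (+ 0) ≡ + 0
contrib-0 out    = refl
contrib-0 inward = refl

contrib-neg : ∀ d x → contrib d (- x) ≡ - contrib d x
contrib-neg out    x = refl
contrib-neg inward x = refl

contrib-flipDir : ∀ d x → contrib (flipDir d) x ≡ - contrib d x
contrib-flipDir out    x = refl
contrib-flipDir inward x = sym (neg-involutive x)

contrib≡0⇒≡0 : ∀ d {x} → contrib d x ≡ + 0 → x ≡ + 0
contrib≡0⇒≡0 out    eq = eq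
contrib≡0⇒≡0 inward eq = neg-injective eq

∣contrib∣ : ∀ d x → ∣ contrib d x ∣ ≡ ∣ x ∣
∣contrib∣ out    x = refl
∣contrib∣ inward x = ∣-i∣≡∣i∣ x

contrib-NZ3 : ∀ d {z} → NZ3 z → NZ3 (contrib d z)
contrib-NZ3 out    nz        = nz
contrib-NZ3 inward plus-one  = minus-one
contrib-NZ3 inward plus-two  = minus-two
contrib-NZ3 inward minus-one = plus-one
contrib-NZ3 inward minus-two = plus-two

contrib-flipIfNeg : ∀ d z → contrib d z ≡ contrib (flipIfNeg z d) (+ ∣ z ∣)
contrib-flipIfNeg out    (+ n)    = refl
contrib-flipIfNeg inward (+ n)    = refl
contrib-flipIfNeg out    -[1+ n ] = refl
contrib-flipIfNeg inward -[1+ n ] = refl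

≢⇒≡flipDir : ∀ {d d'} → d ≢ d' → d' ≡ flipDir d
≢⇒≡flipDir {out}    {out}    d≢d' = ⊥-elim (d≢d' refl)
≢⇒≡flipDir {out}    {inward} _    = refl
≢⇒≡flipDir {inward} {out}    _    = refl
≢⇒≡flipDir {inward} {inward} d≢d' = ⊥-elim (d≢d' refl)

Coherent : List ℤ → Set
Coherent zs = ∀ {x y} → x ∈ zs → y ∈ zs → ∣ x ∣ ≡ ∣ y ∣ → x ≡ y

coherent-map : ∀ {A : Set} (f : A → ℤ) {xs} →
  (∀ {x y} → x ∈ xs → y ∈ xs → ∣ f x ∣ ≡ ∣ f y ∣ → f x ≡ f y) → Coherent (map f xs)
coherent-map f coh x∈ y∈ with ∈-map⁻ f x∈ | ∈-map⁻ f y∈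
... | _ , x∈′ , refl | _ , y∈′ , refl = coh x∈′ y∈′

dirOf : ℕ → List ℤ → Dir
dirOf k zs with + k ∈? zs
... | yes _ = out
... | no  _ = inward

coherent⇒≡dirOf : ∀ {zs z k} → Coherent zs → z ∈ zs → ∣ z ∣ ≡ k → z ≡ contrib (dirOf k zs) (+ k)
coherent⇒≡dirOf {zs} {z} {k} coh z∈ ∣z∣≡k with + k ∈? zs | +∣i∣≡i⊎+∣i∣≡-i z
... | yes k∈ | _        = coh z∈ k∈ ∣z∣≡k
... | no  k∉ | inj₁ eq  = ⊥-elim (k∉ (subst (_∈ zs) (trans (sym eq) (cong +_ ∣z∣≡k)) z∈))
... | no  k∉ | inj₂ eq  = trans (sym (neg-involutive z)) (cong -_ (trans (sym eq) (cong +_ ∣z∣≡k)))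

count-two-values : ∀ {d d' j k} zs → All (λ z → z ≡ contrib d (+ j) ⊎ z ≡ contrib d' (+ k)) zs →
  ∃₂ λ p q → length zs ≡ p ℕ.+ q × sumℤ zs ≡ contrib d (+ (p * j)) + contrib d' (+ (q * k))
count-two-values {d} {d'} [] [] = 0 , 0 , refl , sym (cong₂ _+_ (contrib-0 d) (contrib-0 d'))
count-two-values {d} {d'} {j} {k} (z ∷ zs) (z≡ ∷ vals) with count-two-values {d} {d'} {j} {k} zs vals
... | p , q , len , sum with z≡
...   | inj₁ refl = suc p , q , cong suc len , (begin
  a + sumℤ zs       ≡⟨ cong (λ x → a + x) sum ⟩
  a + (A + B)       ≡⟨ sym (+-assoc a A B) ⟩
  (a + A) + B       ≡⟨ cong (_+ B) (sym (contrib-+ d (+ j) (+ (p * j)))) ⟩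
  contrib d (+ (suc p * j)) + B ∎)
  where
  open ≡-Reasoning
  a = contrib d (+ j); A = contrib d (+ (p * j)); B = contrib d' (+ (q * k))
...   | inj₂ refl = p , suc q , trans (cong suc len) (sym (ℕP.+-suc p q)) , (begin
  b + sumℤ zs       ≡⟨ cong (λ x → b + x) sum ⟩
  b + (A + B)       ≡⟨ sym (+-assoc b A B) ⟩
  (b + A) + B       ≡⟨ cong (_+ B) (+-comm b A) ⟩
  (A + b) + B       ≡⟨ +-assoc A b B ⟩
  A + (b + B)       ≡⟨ cong (λ x → A + x) (sym (contrib-+ d' (+ k) (+ (q * k)))) ⟩
  A + contrib d' (+ (suc q * k)) ∎)
  where
  open ≡-Reasoning
  b = contrib d' (+ k); A = contrib d (+ (p * j)); B = contrib d' (+ (q * k))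

same-direction-empty : ∀ d {zs} → All (λ z → z ≡ contrib d (+ 1) ⊎ z ≡ contrib d (+ 2)) zs →
  sumℤ zs ≡ + 0 → zs ≡ []
same-direction-empty d {[]}     _    _     = refl
same-direction-empty d {z ∷ zs} vals sum≡0 with count-two-values {d} {d} {1} {2} (z ∷ zs) vals
... | p , q , len , sum = case trans len (cong₂ ℕ._+_ p≡0 q≡0) of λ ()
  where
  p*1+q*2≡0 : p * 1 ℕ.+ q * 2 ≡ 0
  p*1+q*2≡0 = ℤP.+-injective (contrib≡0⇒≡0 d (trans (contrib-+ d (+ (p * 1)) (+ (q * 2))) (trans (sym sum) sum≡0)))
  p≡0 : p ≡ 0
  p≡0 = m*n≡0⇒m≡0 p 1 (m+n≡0⇒m≡0 (p * 1) p*1+q*2≡0)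
  q≡0 : q ≡ 0
  q≡0 = m*n≡0⇒m≡0 q 2 (m+n≡0⇒n≡0 (p * 1) p*1+q*2≡0)

opposite-directions-3∣ : ∀ d {zs} →
  All (λ z → z ≡ contrib d (+ 1) ⊎ z ≡ contrib (flipDir d) (+ 2)) zs → sumℤ zs ≡ + 0 → 3 ∣ length zs
opposite-directions-3∣ d {zs} vals sum≡0 with count-two-values {d} {flipDir d} {1} {2} zs vals
... | p , q , len , sum = divides q (begin
  length zs     ≡⟨ len ⟩
  p ℕ.+ q       ≡⟨ cong (ℕ._+ q) (trans (sym (ℕP.*-identityʳ p)) p*1≡q*2) ⟩
  q * 2 ℕ.+ q   ≡⟨ ℕP.+-comm (q * 2) q ⟩
  q ℕ.+ q * 2   ≡⟨ sym (ℕP.*-suc q 2) ⟩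
  q * 3         ∎)
  where
  open ≡-Reasoning
  p*1≡q*2 : p * 1 ≡ q * 2
  p*1≡q*2 = ℤP.+-injective (i-j≡0⇒i≡j _ _ (contrib≡0⇒≡0 d (begin
    contrib d (+ (p * 1) - + (q * 2))         ≡⟨ contrib-+ d (+ (p * 1)) (- + (q * 2)) ⟩
    a + contrib d (- + (q * 2))               ≡⟨ cong (λ x → a + x) (contrib-neg d (+ (q * 2))) ⟩
    a - contrib d (+ (q * 2))                 ≡⟨ cong (λ x → a + x) (sym (contrib-flipDir d (+ (q * 2)))) ⟩
    a + contrib (flipDir d) (+ (q * 2))       ≡⟨ sym sum ⟩
    sumℤ zs                                   ≡⟨ sum≡0 ⟩
    + 0                                       ∎)))
    where a = contrib d (+ (p * 1))

-- This is where the residues agree: 1 ≡ -2 and -1 ≡ 2 (mod 3).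
isOneMod3-opposite-directions : ∀ d {z} → z ≡ contrib d (+ 1) ⊎ z ≡ contrib (flipDir d) (+ 2) →
  isOneMod3 z ≡ isOneMod3 (contrib d (+ 1))
isOneMod3-opposite-directions out    (inj₁ refl) = refl
isOneMod3-opposite-directions out    (inj₂ refl) = refl
isOneMod3-opposite-directions inward (inj₁ refl) = refl
isOneMod3-opposite-directions inward (inj₂ refl) = refl

zero-sum-two-valued : ∀ d d' {zs} → All (λ z → z ≡ contrib d (+ 1) ⊎ z ≡ contrib d' (+ 2)) zs →
  sumℤ zs ≡ + 0 → 3 ∣ length zs × Σ[ b ∈ Bool ] All (λ z → isOneMod3 z ≡ b) zs
zero-sum-two-valued out    out    vals sum≡0 with same-direction-empty out vals sum≡0
... | refl = 3 ∣0 , true , []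
zero-sum-two-valued inward inward vals sum≡0 with same-direction-empty inward vals sum≡0
... | refl = 3 ∣0 , true , []
zero-sum-two-valued out    inward vals sum≡0 =
  opposite-directions-3∣ out vals sum≡0 , true , All.map (isOneMod3-opposite-directions out) vals
zero-sum-two-valued inward out    vals sum≡0 =
  opposite-directions-3∣ inward vals sum≡0 , false , All.map (isOneMod3-opposite-directions inward) vals

zero-sum-coherent : ∀ {zs} → All NZ3 zs → Coherent zs → sumℤ zs ≡ + 0 →
  3 ∣ length zs × Σ[ b ∈ Bool ] All (λ z → isOneMod3 z ≡ b) zs
zero-sum-coherent {zs} nz coh = zero-sum-two-valued (dirOf 1 zs) (dirOf 2 zs) (All.tabulate twoValued)
  where
  twoValued : ∀ {z} → z ∈ zs → z ≡ contrib (dirOf 1 zs) (+ 1) ⊎ z ≡ contrib (dirOf 2 zs) (+ 2)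
  twoValued z∈ = Sum.map (coherent⇒≡dirOf coh z∈) (coherent⇒≡dirOf coh z∈)
                         (NZ3⇒∣∣≡1⊎∣∣≡2 (All.lookup nz z∈))

∈-halfEdgesAt⇒endOf : ∀ {G v h} → h ∈ halfEdgesAt G v → endOf G h ≡ v
∈-halfEdgesAt⇒endOf {G} {v} h∈ = proj₂ (∈-filter⁻ (λ h → endOf G h ≟ᶠ v) {xs = allHalfEdges G} h∈)

∈-halfEdgesAt-endOf : ∀ G h → h ∈ halfEdgesAt G (endOf G h)
∈-halfEdgesAt-endOf G (e , i) =
  ∈-filter⁺ (λ h → endOf G h ≟ᶠ endOf G (e , i)) (∈-cartesianProduct⁺ (∈-allFin e) (∈-allFin i)) refl

module StableFlow (G : SignedGraph) (ω : Orientation G) (ξ : Fin (m G) → ℤ)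
  (valid : ValidOrientation G ω) (flow : IsFlow G ω ξ) (nz : NowhereZero3 G ξ)
  (stable : Stable G ω ξ) where

  contribution : HalfEdge G → ℤ
  contribution h = contrib (ω h) (ξ (proj₁ h))

  contributionsAt : Fin (n G) → List ℤ
  contributionsAt v = map contribution (halfEdgesAt G v)

  contribution-NZ3 : ∀ h → NZ3 (contribution h)
  contribution-NZ3 h = contrib-NZ3 (ω h) (toNZ3 (nz (proj₁ h)))

  coherentAt : ∀ v {h h'} → h ∈ halfEdgesAt G v → h' ∈ halfEdgesAt G v →
    ∣ contribution h ∣ ≡ ∣ contribution h' ∣ → contribution h ≡ contribution h'
  coherentAt v {h} {h'} h∈ h'∈ ∣c∣≡∣c'∣ with ≡-dec _≟ᶠ_ _≟ᶠ_ h h'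
  ... | yes refl = refl
  ... | no  h≢h' = begin
    contribution h                                         ≡⟨ contrib-flipIfNeg (ω h) _ ⟩
    contrib (positiveOrientation G ω ξ h) (+ value h)      ≡⟨ cong₂ (λ d k → contrib d (+ k)) same-direction same-value ⟩
    contrib (positiveOrientation G ω ξ h') (+ value h')    ≡⟨ sym (contrib-flipIfNeg (ω h') _) ⟩
    contribution h'                                        ∎
    where
    open ≡-Reasoning
    value : HalfEdge G → ℕ
    value = positiveValue G ξ ∘ proj₁
    same-value : value h ≡ value h'
    same-value = trans (sym (∣contrib∣ (ω h) _)) (trans ∣c∣≡∣c'∣ (∣contrib∣ (ω h') _))
    same-direction : positiveOrientation G ω ξ h ≡ positiveOrientation G ω ξ h'
    same-direction = stable v h h' h≢h' (∈-halfEdgesAt⇒endOf h∈) (∈-halfEdgesAt⇒endOf h'∈) same-value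

  balanceAt : ∀ v → 3 ∣ length (contributionsAt v) × Σ[ b ∈ Bool ] All (λ z → isOneMod3 z ≡ b) (contributionsAt v)
  balanceAt v = zero-sum-coherent (All.tabulate nz3∈) (coherent-map contribution (coherentAt v)) (flow v)
    where
    nz3∈ : ∀ {z} → z ∈ contributionsAt v → NZ3 z
    nz3∈ z∈ with ∈-map⁻ contribution z∈
    ... | h , _ , refl = contribution-NZ3 h

  3∣valency : ∀ v → 3 ∣ valency G v
  3∣valency v = subst (3 ∣_) (length-map contribution (halfEdgesAt G v)) (proj₁ (balanceAt v))

  residueAt : Fin (n G) → Bool
  residueAt v = proj₁ (proj₂ (balanceAt v))

  isOneMod3-contribution : ∀ h → isOneMod3 (contribution h) ≡ residueAt (endOf G h)
  isOneMod3-contribution h =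
    All.lookup (map⁻ (proj₂ (proj₂ (balanceAt (endOf G h))))) (∈-halfEdgesAt-endOf G h)

  isPositive≡residue-change : ∀ e → does (isNeg (negateSign (σ G e))) ≡
    isOneMod3 (contribution (e , zero)) xor isOneMod3 (contribution (e , suc zero))
  isPositive≡residue-change e with σ G e | valid e
  ... | pos | ω₀≢ω₁ = sym (begin
    isOneMod3 c₀ xor isOneMod3 c₁        ≡⟨ cong (λ z → isOneMod3 c₀ xor isOneMod3 z) c₁≡-c₀ ⟩
    isOneMod3 c₀ xor isOneMod3 (- c₀)    ≡⟨ cong (isOneMod3 c₀ xor_) (isOneMod3-neg (contribution-NZ3 (e , zero))) ⟩
    isOneMod3 c₀ xor not (isOneMod3 c₀)  ≡⟨ xor-not-self (isOneMod3 c₀) ⟩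
    true                                 ∎)
    where
    open ≡-Reasoning
    c₀ = contribution (e , zero)
    c₁ = contribution (e , suc zero)
    c₁≡-c₀ : c₁ ≡ - c₀
    c₁≡-c₀ = trans (cong (λ d → contrib d (ξ e)) (≢⇒≡flipDir ω₀≢ω₁)) (contrib-flipDir (ω (e , zero)) (ξ e))
  ... | neg | ω₀≡ω₁ rewrite ω₀≡ω₁ = sym (xor-same (isOneMod3 (contribution (e , suc zero))))

  isPositive≡residueAt-change : ∀ {e u w} → Joins G e u w →
    does (isNeg (negateSign (σ G e))) ≡ residueAt u xor residueAt w
  isPositive≡residueAt-change {e} {u} {w} joins = begin
    does (isNeg (negateSign (σ G e)))              ≡⟨ isPositive≡residue-change e ⟩
    isOneMod3 (contribution (e , zero)) xor isOneMod3 (contribution (e , suc zero))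
      ≡⟨ cong₂ _xor_ (isOneMod3-contribution (e , zero)) (isOneMod3-contribution (e , suc zero)) ⟩
    residueAt (proj₁ (ends G e)) xor residueAt (proj₂ (ends G e))
      ≡⟨ ends-change joins ⟩
    residueAt u xor residueAt w                    ∎
    where
    open ≡-Reasoning
    change : Fin (n G) × Fin (n G) → Bool
    change (x , y) = residueAt x xor residueAt y
    ends-change : Joins G e u w → change (ends G e) ≡ residueAt u xor residueAt w
    ends-change (inj₁ ends≡) = cong change ends≡
    ends-change (inj₂ ends≡) = trans (cong change ends≡) (xor-comm (residueAt w) (residueAt u))

  antibalanced : Antibalanced G
  antibalanced C = isOdd≡false⇒2∣ _ (begin
    isOdd (numNegative (negateSignature G) C)
      ≡⟨ isOdd-count-changes (λ i → isNeg (negateSign (σ G (edge i)))) (suc len-1) id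
           (residueAt ∘ vert) (isPositive≡residueAt-change ∘ joins) ⟩
    residueAt (vert zero) xor residueAt (vert (fromℕ (suc len-1))) ≡⟨ cong (λ v → residueAt (vert zero) xor residueAt v) closed ⟩
    residueAt (vert zero) xor residueAt (vert zero)                ≡⟨ xor-same (residueAt (vert zero)) ⟩
    false                                                          ∎)
    where
    open Circuit C
    open ≡-Reasoning

lemma13 : (G : SignedGraph) → Eulerian G → AdmitsStableNZ3Flow G →
    Antibalanced G × (∀ v → 6 ∣ valency G v)
lemma13 G (_ , 2∣valency) (ω , ξ , valid , flow , nz , stable) =
  antibalanced , λ v → lcm-least (2∣valency v) (3∣valency v)
  where open StableFlow G ω ξ valid flow nz stable
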